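{- Let $p$ be a prime and $n,K$ positive integers. (1) If $p^K\equiv 1\pmod n$, then $P(p,n)$ divides $p^K-1$. (2) If $p^K\equiv -1\pmod n$, then $P(p,n)$ divides $n(p^K-1)$.
   Context: For positive integers $m,n$, let $\mathbf{Z}_m$ be the ring of integers modulo $m$ and define $T:\mathbf{Z}_m^n\to\mathbf{Z}_m^n$ by $T(a_0,\dots,a_{n-1})=(a_0+a_1,a_1+a_2,\dots,a_{n-2}+a_{n-1},a_{n-1}+a_0)$. For $\mathbf{a}\in\mathbf{Z}_m^n$, the cycle length of $(T^k\mathbf{a})_{k\ge0}$ is the smallest positive integer $P$ for which there exists $N$ with $T^{k+P}\mathbf{a}=T^k\mathbf{a}$ for all $k\ge N$. The period $P(m,n)$ is the maximum of these cycle lengths over all $\mathbf{a}\in\mathbf{Z}_m^n$. -}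

module Defs where

open import Data.Nat using (ℕ; zero; suc; _+_; _≤_; _<_)
open import Data.Nat.DivMod using (_%_; m%n<n)
open import Data.Fin using (Fin; toℕ; fromℕ<)
open import Data.Product using (Σ; _×_; ∃-syntax)
open import Relation.Binary.PropositionalEquality using (_≡_)

-- Z_m is represented by Fin m (residues 0,…,m-1).
-- Addition in Z_m (for m = 0 the type Fin 0 is empty, so only m = suc k matters).
_+ᶻ_ : ∀ {m} → Fin m → Fin m → Fin m
_+ᶻ_ {suc k} x y = fromℕ< (m%n<n (toℕ x + toℕ y) (suc k))

nextIdx : ∀ {n} → Fin n → Fin n
nextIdx {suc k} i = fromℕ< (m%n<n (suc (toℕ i)) (suc k))

Vecᶻ : ℕ → ℕ → Set
Vecᶻ m n = Fin n → Fin m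

T : ∀ {m n} → Vecᶻ m n → Vecᶻ m n
T a i = a i +ᶻ a (nextIdx i)

Tⁱ : ∀ {m n} → ℕ → Vecᶻ m n → Vecᶻ m n
Tⁱ zero    a = a
Tⁱ (suc k) a = T (Tⁱ k a)

IsEventualPeriod : ∀ {m n} → Vecᶻ m n → ℕ → Set
IsEventualPeriod a P =
  ∃[ N ] (∀ k → N ≤ k → ∀ i → Tⁱ (k + P) a i ≡ Tⁱ k a i)

IsCycleLength : ∀ {m n} → Vecᶻ m n → ℕ → Set
IsCycleLength a P =
  0 < P × IsEventualPeriod a P ×
  (∀ Q → 0 < Q → IsEventualPeriod a Q → P ≤ Q)

IsPeriod : ℕ → ℕ → ℕ → Set
IsPeriod m n P =
  (Σ (Vecᶻ m n) λ a → IsCycleLength a P) ×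
  (∀ (a : Vecᶻ m n) Q → IsCycleLength a Q → Q ≤ P)

-- Over Z_p the map T is I + S for the cyclic shift S, and since p divides the
-- binomial coefficients C(p,l) for 0 < l < p, the Frobenius identity
-- (I + Sʳ)ᵖ = I + Sᵖʳ holds; by induction T^(p^K) = I + S^(p^K). If p^K ≡ 1 (mod n)
-- this is T itself, so every orbit is periodic with period p^K - 1 from its first
-- step on. If p^K ≡ -1 (mod n) it is S⁻¹T, so T^(1 + c(p^K - 1)) = S⁻ᶜT and
-- n(p^K - 1) is a common period of all orbits. A common period D forces every cycle
-- length to divide D, and P(p,n), the largest cycle length over the finite set
-- Z_pⁿ, is one of them.
module Submission where

open import Defs
open import Data.Nat using (ℕ; zero; suc; _+_; _*_; _^_; _∸_; _<_; _≤_; z<s; s≤s; s<s;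
  NonZero; >-nonZero; >-nonZero⁻¹; nonTrivial⇒n>1)
open import Data.Nat.Properties using (+-comm; +-assoc; +-identityʳ; *-comm; *-zeroʳ; *-identityˡ;
  *-identityʳ; *-distribˡ-+; *-distribʳ-+; *-mono-≤; ^-monoʳ-<; m^n>0; m≤m*n; n<1+n; m<n⇒m<1+n;
  m≤n⇒m≤1+n; m<1+n⇒m<n∨m≡n; <⇒≱; ≮⇒≥; ≤-antisym; m+[n∸m]≡n; m∸n+n≡m; m<n⇒0<n∸m;
  +-commutativeSemigroup; +-0-commutativeMonoid)
open import Data.Nat.DivMod using (_%_; _/_; m≡m%n+[m/n]*n; m%n<n; m%n%n≡m%n; %-distribˡ-+;
  %-remove-+ˡ; m<n⇒m%n≡m; [m+kn]%n≡m%n; [m+n]%n≡m%n)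
open import Data.Nat.Divisibility using (_∣_; _∣0; divides; m%n≡0⇒n∣m; ∣m∣n⇒∣m+n; ∣m⇒∣m*n; ∣⇒≤)
open import Data.Nat.Primality using (Prime; euclidsLemma; prime⇒nonZero; prime⇒nonTrivial)
open import Data.Nat.Combinatorics using (_C_; nCk+nC[k+1]≡[n+1]C[k+1]; nCn≡1; nC1≡n)
open import Data.Nat.GeneralisedArithmetic using (fold)
open import Algebra.Properties.CommutativeSemigroup +-commutativeSemigroup using (x∙yz≈y∙xz; xy∙z≈x∙zy)
open import Algebra.Properties.CommutativeMonoid.Sum +-0-commutativeMonoid
  using (sum-syntax; ∑-distrib-+; sum-cong-≗; sum-init-last; sum-replicate-zero)
open import Data.Fin using (Fin; toℕ; fromℕ<; fromℕ; inject₁; _≟_; finToFun; funToFin)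
  renaming (zero to fzero; suc to fsuc)
open import Data.Fin.Properties using (toℕ-injective; toℕ-fromℕ<; toℕ-fromℕ; toℕ<n; toℕ-inject₁;
  all?; finToFun-funToFin)
open import Data.List using (allFin)
open import Data.List.Extrema.Nat using (argmax; f[xs]≤f[argmax])
open import Data.List.Membership.Propositional.Properties using (∈-allFin)
import Data.List.Relation.Unary.All as All
open import Data.Product using (Σ; ∃-syntax; _×_; _,_; proj₁; proj₂)
open import Data.Sum using (_⊎_; inj₁; inj₂; [_,_]′)
open import Function using (_∘_)
open import Relation.Nullary using (Dec; yes; no; ¬_; contradiction)
open import Relation.Unary using (Decidable)
open import Relation.Binary.PropositionalEquality

module _ {P : ℕ → Set} (P? : Decidable P) where

  private
    search : ∀ b → (∀ {q} → q < b → ¬ P q) ⊎ (Σ ℕ λ m → P m × (∀ {q} → q < m → ¬ P q))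
    search zero = inj₁ λ ()
    search (suc b) with search b | P? b
    ... | inj₂ found | _      = inj₂ found
    ... | inj₁ none  | yes Pb = inj₂ (b , Pb , none)
    ... | inj₁ none  | no ¬Pb = inj₁ λ q<1+b → [ none , (λ { refl → ¬Pb }) ]′ (m<1+n⇒m<n∨m≡n q<1+b)

  least : ∀ {d} → P d → Σ ℕ λ m → P m × (∀ {q} → P q → m ≤ q)
  least {d} Pd with search (suc d)
  ... | inj₁ none = contradiction Pd (none (n<1+n d))
  ... | inj₂ (m , Pm , below) = m , Pm , λ Pq → ≮⇒≥ (λ q<m → below q<m Pq)

argmax-Vecᶻ : ∀ {m n} (f : Vecᶻ m n → ℕ) → (∀ {a b} → a ≗ b → f a ≡ f b) →
              Vecᶻ m n → Σ (Vecᶻ m n) λ a → ∀ b → f b ≤ f a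
argmax-Vecᶻ {m} {n} f f-cong a₀ = finToFun best , bound
  where
    best : Fin (m ^ n)
    best = argmax (f ∘ finToFun) (funToFin a₀) (allFin (m ^ n))

    bound : ∀ b → f b ≤ f (finToFun best)
    bound b = subst (_≤ f (finToFun best)) (f-cong (finToFun-funToFin b))
      (All.lookup (f[xs]≤f[argmax] {f = f ∘ finToFun} (funToFin a₀) (allFin (m ^ n)))
                  (∈-allFin (funToFin b)))

module _ {m n : ℕ} where

  T-cong : ∀ {a b : Vecᶻ m n} → a ≗ b → T a ≗ T b
  T-cong a≗b i = cong₂ _+ᶻ_ (a≗b i) (a≗b (nextIdx i))

  Tⁱ-cong : ∀ k {a b : Vecᶻ m n} → a ≗ b → Tⁱ k a ≗ Tⁱ k b
  Tⁱ-cong zero    a≗b = a≗b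
  Tⁱ-cong (suc k) a≗b = T-cong (Tⁱ-cong k a≗b)

  Tⁱ-+ : ∀ j k (a : Vecᶻ m n) → Tⁱ (j + k) a ≡ Tⁱ j (Tⁱ k a)
  Tⁱ-+ zero    k a = refl
  Tⁱ-+ (suc j) k a = cong T (Tⁱ-+ j k a)

  Tⁱ-suc : ∀ k (a : Vecᶻ m n) → Tⁱ (suc k) a ≡ Tⁱ k (T a)
  Tⁱ-suc k a = trans (cong (λ j → Tⁱ j a) (+-comm 1 k)) (Tⁱ-+ k 1 a)

  Tⁱ-fixed-* : ∀ {Q} {b : Vecᶻ m n} → Tⁱ Q b ≗ b → ∀ c → Tⁱ (c * Q) b ≗ b
  Tⁱ-fixed-* fixed zero    = λ _ → refl
  Tⁱ-fixed-* {Q} {b} fixed (suc c) i = begin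
    Tⁱ (Q + c * Q) b i   ≡⟨ cong (λ x → x i) (Tⁱ-+ Q (c * Q) b) ⟩
    Tⁱ Q (Tⁱ (c * Q) b) i ≡⟨ Tⁱ-cong Q (Tⁱ-fixed-* fixed c) i ⟩
    Tⁱ Q b i              ≡⟨ fixed i ⟩
    b i                   ∎
    where open ≡-Reasoning

  Tⁱ-fixed-+* : ∀ {Q} {b : Vecᶻ m n} → Tⁱ Q b ≗ b → ∀ k c → Tⁱ (k + c * Q) b ≗ Tⁱ k b
  Tⁱ-fixed-+* {Q} {b} fixed k c i =
    trans (cong (λ x → x i) (Tⁱ-+ k (c * Q) b)) (Tⁱ-cong k (Tⁱ-fixed-* fixed c) i)

  Tⁱ-*-fold : ∀ {f : Vecᶻ m n → Vecᶻ m n} → (∀ {a b} → a ≗ b → f a ≗ f b) →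
              ∀ {j} → (∀ a → Tⁱ j a ≗ f a) → ∀ c a → Tⁱ (c * j) a ≗ fold a f c
  Tⁱ-*-fold f-cong Tʲ≗f zero    a i = refl
  Tⁱ-*-fold f-cong {j} Tʲ≗f (suc c) a i =
    trans (cong (λ x → x i) (Tⁱ-+ j (c * j) a))
          (trans (Tʲ≗f _ i) (f-cong (Tⁱ-*-fold f-cong Tʲ≗f c a) i))

  Periodic₁ : Vecᶻ m n → ℕ → Set
  Periodic₁ a Q = Tⁱ Q (T a) ≗ T a

  periodic₁? : ∀ a Q → Dec (Periodic₁ a Q)
  periodic₁? a Q = all? (λ i → Tⁱ Q (T a) i ≟ T a i)

  periodic₁-% : ∀ {a : Vecᶻ m n} {Q D} .{{_ : NonZero Q}} →
                Periodic₁ a Q → Periodic₁ a D → Periodic₁ a (D % Q)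
  periodic₁-% {a} {Q} {D} PQ PD i = begin
    Tⁱ (D % Q) (T a) i               ≡⟨ Tⁱ-fixed-+* PQ (D % Q) (D / Q) i ⟨
    Tⁱ (D % Q + D / Q * Q) (T a) i   ≡⟨ cong (λ x → Tⁱ x (T a) i) (m≡m%n+[m/n]*n D Q) ⟨
    Tⁱ D (T a) i                     ≡⟨ PD i ⟩
    T a i                            ∎
    where open ≡-Reasoning

  periodic₁⇒eventualPeriod : ∀ {a : Vecᶻ m n} {Q} → Periodic₁ a Q → IsEventualPeriod a Q
  periodic₁⇒eventualPeriod {a} {Q} PQ = 1 , λ { (suc k) _ i → begin
    Tⁱ (suc k + Q) a i       ≡⟨ cong (λ x → x i) (Tⁱ-suc (k + Q) a) ⟩
    Tⁱ (k + Q) (T a) i       ≡⟨ cong (λ x → x i) (Tⁱ-+ k Q (T a)) ⟩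
    Tⁱ k (Tⁱ Q (T a)) i      ≡⟨ Tⁱ-cong k PQ i ⟩
    Tⁱ k (T a) i             ≡⟨ cong (λ x → x i) (Tⁱ-suc k a) ⟨
    Tⁱ (suc k) a i           ∎ }
    where open ≡-Reasoning

  eventualPeriod⇒periodic₁ : ∀ {a : Vecᶻ m n} {D Q} → 0 < D → Periodic₁ a D →
                             IsEventualPeriod a Q → Periodic₁ a Q
  eventualPeriod⇒periodic₁ {a} {D} {Q} 0<D PD (N , eventual) i = begin
    Tⁱ Q (T a) i                ≡⟨ Tⁱ-fixed-+* PD Q N i ⟨
    Tⁱ (Q + N * D) (T a) i      ≡⟨ cong (λ x → x i) (Tⁱ-suc (Q + N * D) a) ⟨
    Tⁱ (suc (Q + N * D)) a i    ≡⟨ cong (λ x → Tⁱ (suc x) a i) (+-comm Q (N * D)) ⟩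
    Tⁱ (suc (N * D) + Q) a i    ≡⟨ eventual (suc (N * D)) N≤1+N*D i ⟩
    Tⁱ (suc (N * D)) a i        ≡⟨ cong (λ x → x i) (Tⁱ-suc (N * D) a) ⟩
    Tⁱ (N * D) (T a) i          ≡⟨ Tⁱ-fixed-* PD N i ⟩
    T a i                       ∎
    where
      open ≡-Reasoning
      N≤1+N*D : N ≤ suc (N * D)
      N≤1+N*D = m≤n⇒m≤1+n (m≤m*n N D {{>-nonZero 0<D}})

  eventualPeriod-cong : ∀ {a b : Vecᶻ m n} {Q} →
                        a ≗ b → IsEventualPeriod a Q → IsEventualPeriod b Q
  eventualPeriod-cong {Q = Q} a≗b (N , eventual) = N , λ k N≤k i →
    trans (sym (Tⁱ-cong (k + Q) a≗b i)) (trans (eventual k N≤k i) (Tⁱ-cong k a≗b i))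

  isCycleLength-cong : ∀ {a b : Vecᶻ m n} {P} → a ≗ b → IsCycleLength a P → IsCycleLength b P
  isCycleLength-cong {a} {b} a≗b (0<P , period , minimal) =
    0<P , eventualPeriod-cong a≗b period ,
    λ Q 0<Q periodQ → minimal Q 0<Q (eventualPeriod-cong (λ i → sym (a≗b i)) periodQ)

  isCycleLength-unique : ∀ {a : Vecᶻ m n} {P Q} → IsCycleLength a P → IsCycleLength a Q → P ≡ Q
  isCycleLength-unique (0<P , periodP , minimalP) (0<Q , periodQ , minimalQ) =
    ≤-antisym (minimalP _ 0<Q periodQ) (minimalQ _ 0<P periodP)

  cycleLength : ∀ {a : Vecᶻ m n} {D} → 0 < D → Periodic₁ a D → Σ ℕ (IsCycleLength a)
  cycleLength {a} {suc D} 0<D PD with least (λ q → periodic₁? a (suc q)) {D} PD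
  ... | k , Pk , minimal = suc k , z<s , periodic₁⇒eventualPeriod Pk ,
    λ { (suc Q) _ periodQ → s≤s (minimal (eventualPeriod⇒periodic₁ 0<D PD periodQ)) }

  isCycleLength-∣ : ∀ {a : Vecᶻ m n} {D P} → 0 < D → Periodic₁ a D → IsCycleLength a P → P ∣ D
  isCycleLength-∣ {a} {D} {P} 0<D PD (0<P , periodP , minimal) = m%n≡0⇒n∣m D P D%P≡0
    where
      instance _ = >-nonZero 0<P
      D%P≡0 : D % P ≡ 0
      D%P≡0 with D % P | m%n<n D P | periodic₁-% {a} {P} {D} (eventualPeriod⇒periodic₁ 0<D PD periodP) PD
      ... | zero  | _   | _   = refl
      ... | suc r | r<P | Pr = contradiction (minimal (suc r) z<s (periodic₁⇒eventualPeriod Pr)) (<⇒≱ r<P)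

uniformPeriod⇒period-∣ : ∀ {m n D} → Vecᶻ m n → 0 < D → (∀ (a : Vecᶻ m n) → Periodic₁ a D) →
                         ∃[ P ] (IsPeriod m n P × P ∣ D)
uniformPeriod⇒period-∣ {m} {n} a₀ 0<D periodic =
  cl a* , ((a* , cl-spec a*) , maximal) , isCycleLength-∣ 0<D (periodic a*) (cl-spec a*)
  where
    cl : Vecᶻ m n → ℕ
    cl a = proj₁ (cycleLength 0<D (periodic a))

    cl-spec : ∀ a → IsCycleLength a (cl a)
    cl-spec a = proj₂ (cycleLength 0<D (periodic a))

    cl-cong : ∀ {a b} → a ≗ b → cl a ≡ cl b
    cl-cong {a} {b} a≗b = isCycleLength-unique (isCycleLength-cong a≗b (cl-spec a)) (cl-spec b)

    a* : Vecᶻ m n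
    a* = proj₁ (argmax-Vecᶻ cl cl-cong a₀)

    maximal : ∀ b Q → IsCycleLength b Q → Q ≤ cl a*
    maximal b Q Q-spec =
      subst (_≤ cl a*) (isCycleLength-unique (cl-spec b) Q-spec) (proj₂ (argmax-Vecᶻ cl cl-cong a₀) b)

[1+k]*[1+n]C[1+k]≡[1+n]*nCk : ∀ n k → suc k * (suc n C suc k) ≡ suc n * (n C k)
[1+k]*[1+n]C[1+k]≡[1+n]*nCk zero    zero    = refl
[1+k]*[1+n]C[1+k]≡[1+n]*nCk zero    (suc k) = *-zeroʳ (suc (suc k))
[1+k]*[1+n]C[1+k]≡[1+n]*nCk (suc n) zero    =
  trans (+-identityʳ _) (trans (nC1≡n (suc (suc n))) (sym (*-identityʳ _)))
[1+k]*[1+n]C[1+k]≡[1+n]*nCk (suc n) (suc k) = begin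
  suc (suc k) * (suc (suc n) C suc (suc k))     ≡⟨ cong (suc (suc k) *_) (pascal (suc n) (suc k)) ⟨
  suc (suc k) * (X + Y)                         ≡⟨ *-distribˡ-+ (suc (suc k)) X Y ⟩
  (X + suc k * X) + suc (suc k) * Y             ≡⟨ cong₂ (λ u v → (X + u) + v)
                                                     ([1+k]*[1+n]C[1+k]≡[1+n]*nCk n k)
                                                     ([1+k]*[1+n]C[1+k]≡[1+n]*nCk n (suc k)) ⟩
  (X + suc n * (n C k)) + suc n * (n C suc k)   ≡⟨ +-assoc X _ _ ⟩
  X + (suc n * (n C k) + suc n * (n C suc k))   ≡⟨ cong (X +_) (*-distribˡ-+ (suc n) (n C k) (n C suc k)) ⟨
  X + suc n * (n C k + n C suc k)               ≡⟨ cong (λ u → X + suc n * u) (pascal n k) ⟩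
  X + suc n * X                                 ∎
  where
    open ≡-Reasoning
    pascal = nCk+nC[k+1]≡[n+1]C[k+1]
    X = suc n C suc k
    Y = suc n C suc (suc k)

p∣pC[1+k] : ∀ {p k} → Prime p → suc k < p → p ∣ p C suc k
p∣pC[1+k] {suc q} {k} p-prime 1+k<p
  with euclidsLemma (suc k) (suc q C suc k) p-prime
         (divides (q C k) (trans ([1+k]*[1+n]C[1+k]≡[1+n]*nCk q k) (*-comm (suc q) (q C k))))
... | inj₁ p∣1+k = contradiction (∣⇒≤ p∣1+k) (<⇒≱ 1+k<p)
... | inj₂ p∣C   = p∣C

∣-∑ : ∀ {d N} (f : Fin N → ℕ) → (∀ l → d ∣ f l) → d ∣ ∑[ l < N ] f l
∣-∑ {d} {zero}  f d∣f = d ∣0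
∣-∑ {N = suc N} f d∣f = ∣m∣n⇒∣m+n (d∣f fzero) (∣-∑ (f ∘ fsuc) (d∣f ∘ fsuc))

-- k C 0 reduces to 1, so the l = 0 terms of these sums appear as 1 * w 0.
∑-pascal : ∀ k N (w : ℕ → ℕ) →
  ∑[ l < suc N ] ((k C toℕ l) * w (toℕ l)) + ∑[ l < N ] ((k C toℕ l) * w (suc (toℕ l)))
    ≡ ∑[ l < suc N ] ((suc k C toℕ l) * w (toℕ l))
∑-pascal k N w = begin
  (1 * w 0 + ∑[ l < N ] c (suc (toℕ l))) + ∑[ l < N ] c′ (toℕ l)
    ≡⟨ xy∙z≈x∙zy (1 * w 0) _ _ ⟩
  1 * w 0 + (∑[ l < N ] c′ (toℕ l) + ∑[ l < N ] c (suc (toℕ l)))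
    ≡⟨ cong (1 * w 0 +_) (∑-distrib-+ {N} (λ l → c′ (toℕ l)) (λ l → c (suc (toℕ l)))) ⟨
  1 * w 0 + ∑[ l < N ] (c′ (toℕ l) + c (suc (toℕ l)))
    ≡⟨ cong (1 * w 0 +_) (sum-cong-≗ pascal) ⟩
  1 * w 0 + ∑[ l < N ] ((suc k C suc (toℕ l)) * w (suc (toℕ l)))  ∎
  where
    open ≡-Reasoning
    c c′ : ℕ → ℕ
    c  l = (k C l) * w l
    c′ l = (k C l) * w (suc l)
    pascal : ∀ (l : Fin N) → c′ (toℕ l) + c (suc (toℕ l)) ≡ (suc k C suc (toℕ l)) * w (suc (toℕ l))
    pascal l = trans (sym (*-distribʳ-+ (w (suc (toℕ l))) (k C toℕ l) (k C suc (toℕ l))))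
                     (cong (_* w (suc (toℕ l))) (nCk+nC[k+1]≡[n+1]C[k+1] k (toℕ l)))

∑-C-prime : ∀ {p} .{{_ : NonZero p}} → Prime p → (w : ℕ → ℕ) →
            (∑[ l < suc p ] ((p C toℕ l) * w (toℕ l))) % p ≡ (w 0 + w p) % p
∑-C-prime {suc q} p-prime w = begin
  (1 * w 0 + ∑[ l < suc q ] g l) % p          ≡⟨ cong (λ x → (1 * w 0 + x) % p) (sum-init-last g) ⟩
  (1 * w 0 + (M + g (fromℕ q))) % p           ≡⟨ cong (_% p) (x∙yz≈y∙xz (1 * w 0) M _) ⟩
  (M + (1 * w 0 + g (fromℕ q))) % p           ≡⟨ %-remove-+ˡ _ p∣M ⟩
  (1 * w 0 + g (fromℕ q)) % p                 ≡⟨ cong₂ (λ x y → (x + y) % p) (*-identityˡ (w 0)) last≡ ⟩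
  (w 0 + w p) % p                             ∎
  where
    open ≡-Reasoning
    p = suc q
    g : Fin p → ℕ
    g l = (p C suc (toℕ l)) * w (suc (toℕ l))
    M = ∑[ l < q ] g (inject₁ l)
    p∣M : p ∣ M
    p∣M = ∣-∑ (g ∘ inject₁) λ l →
      ∣m⇒∣m*n _ (p∣pC[1+k] p-prime (s<s (subst (_< q) (sym (toℕ-inject₁ l)) (toℕ<n l))))
    last≡ : g (fromℕ q) ≡ w p
    last≡ = trans (cong (λ x → (p C suc x) * w (suc x)) (toℕ-fromℕ q))
                  (trans (cong (_* w p) (nCn≡1 p)) (*-identityˡ (w p)))

module _ {n : ℕ} .{{_ : NonZero n}} where

  +-%-congʳ : ∀ a {r s} → r % n ≡ s % n → (a + r) % n ≡ (a + s) % n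
  +-%-congʳ a {r} {s} eq = begin
    (a + r) % n             ≡⟨ %-distribˡ-+ a r n ⟩
    (a % n + r % n) % n     ≡⟨ cong (λ x → (a % n + x) % n) eq ⟩
    (a % n + s % n) % n     ≡⟨ %-distribˡ-+ a s n ⟨
    (a + s) % n             ∎
    where open ≡-Reasoning

  infixl 6 _⊕_
  _⊕_ : Fin n → ℕ → Fin n
  i ⊕ r = fromℕ< (m%n<n (toℕ i + r) n)

  toℕ-⊕ : ∀ i r → toℕ (i ⊕ r) ≡ (toℕ i + r) % n
  toℕ-⊕ i r = toℕ-fromℕ< _

  ⊕-cong : ∀ i {r s} → r % n ≡ s % n → i ⊕ r ≡ i ⊕ s
  ⊕-cong i {r} {s} eq = toℕ-injective (begin
    toℕ (i ⊕ r)       ≡⟨ toℕ-⊕ i r ⟩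
    (toℕ i + r) % n   ≡⟨ +-%-congʳ (toℕ i) eq ⟩
    (toℕ i + s) % n   ≡⟨ toℕ-⊕ i s ⟨
    toℕ (i ⊕ s)       ∎)
    where open ≡-Reasoning

  ⊕-assoc : ∀ i r s → i ⊕ r ⊕ s ≡ i ⊕ (r + s)
  ⊕-assoc i r s = toℕ-injective (begin
    toℕ (i ⊕ r ⊕ s)               ≡⟨ toℕ-⊕ (i ⊕ r) s ⟩
    (toℕ (i ⊕ r) + s) % n         ≡⟨ cong (λ x → (x + s) % n) (toℕ-⊕ i r) ⟩
    ((toℕ i + r) % n + s) % n     ≡⟨ cong (_% n) (+-comm _ s) ⟩
    (s + (toℕ i + r) % n) % n     ≡⟨ +-%-congʳ s (m%n%n≡m%n (toℕ i + r) n) ⟩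
    (s + (toℕ i + r)) % n         ≡⟨ cong (_% n) (trans (+-comm s _) (+-assoc (toℕ i) r s)) ⟩
    (toℕ i + (r + s)) % n         ≡⟨ toℕ-⊕ i (r + s) ⟨
    toℕ (i ⊕ (r + s))             ∎)
    where open ≡-Reasoning

  ⊕-identityʳ : ∀ i → i ⊕ 0 ≡ i
  ⊕-identityʳ i = toℕ-injective (trans (toℕ-⊕ i 0)
    (trans (cong (_% n) (+-identityʳ (toℕ i))) (m<n⇒m%n≡m (toℕ<n i))))

  ⊕-* : ∀ i k → i ⊕ k * n ≡ i
  ⊕-* i k = toℕ-injective (trans (toℕ-⊕ i (k * n))
    (trans ([m+kn]%n≡m%n (toℕ i) k n) (m<n⇒m%n≡m (toℕ<n i))))

  ∣∸1⇒%≡1 : ∀ {j} → 0 < j → n ∣ j ∸ 1 → j % n ≡ 1 % n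
  ∣∸1⇒%≡1 {j} 0<j (divides c j∸1≡c*n) = begin
    j % n               ≡⟨ cong (_% n) (m+[n∸m]≡n 0<j) ⟨
    (1 + (j ∸ 1)) % n   ≡⟨ cong (λ x → (1 + x) % n) j∸1≡c*n ⟩
    (1 + c * n) % n     ≡⟨ [m+kn]%n≡m%n 1 c n ⟩
    1 % n               ∎
    where open ≡-Reasoning

  ∣+1⇒%≡-1 : ∀ {j} → n ∣ j + 1 → j % n ≡ (n ∸ 1) % n
  ∣+1⇒%≡-1 {j} (divides c j+1≡c*n) = begin
    j % n                       ≡⟨ [m+n]%n≡m%n j n ⟨
    (j + n) % n                 ≡⟨ cong (λ x → (j + x) % n) (m+[n∸m]≡n (>-nonZero⁻¹ n)) ⟨
    (j + (1 + (n ∸ 1))) % n     ≡⟨ cong (_% n) (+-assoc j 1 (n ∸ 1)) ⟨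
    (j + 1 + (n ∸ 1)) % n       ≡⟨ cong (λ x → (x + (n ∸ 1)) % n) j+1≡c*n ⟩
    (c * n + (n ∸ 1)) % n       ≡⟨ cong (_% n) (+-comm (c * n) (n ∸ 1)) ⟩
    (n ∸ 1 + c * n) % n         ≡⟨ [m+kn]%n≡m%n (n ∸ 1) c n ⟩
    (n ∸ 1) % n                 ∎
    where open ≡-Reasoning

nextIdx≡⊕1 : ∀ {n} .{{_ : NonZero n}} (i : Fin n) → nextIdx i ≡ i ⊕ 1
nextIdx≡⊕1 {suc n} i = toℕ-injective
  (trans (toℕ-fromℕ< _) (trans (cong (_% suc n) (+-comm 1 (toℕ i))) (sym (toℕ-⊕ i 1))))

nextIdx-⊕-∸1 : ∀ {n} .{{_ : NonZero n}} (i : Fin n) → nextIdx (i ⊕ (n ∸ 1)) ≡ i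
nextIdx-⊕-∸1 {n} i = begin
  nextIdx (i ⊕ (n ∸ 1))   ≡⟨ nextIdx≡⊕1 (i ⊕ (n ∸ 1)) ⟩
  i ⊕ (n ∸ 1) ⊕ 1         ≡⟨ ⊕-assoc i (n ∸ 1) 1 ⟩
  i ⊕ (n ∸ 1 + 1)         ≡⟨ cong (i ⊕_) (trans (m∸n+n≡m (>-nonZero⁻¹ n)) (sym (*-identityˡ n))) ⟩
  i ⊕ 1 * n               ≡⟨ ⊕-* i 1 ⟩
  i                       ∎
  where open ≡-Reasoning

toℕ-+ᶻ : ∀ {m} .{{_ : NonZero m}} (x y : Fin m) → toℕ (x +ᶻ y) ≡ (toℕ x + toℕ y) % m
toℕ-+ᶻ {suc m} x y = toℕ-fromℕ< _

+ᶻ-comm : ∀ {m} (x y : Fin m) → x +ᶻ y ≡ y +ᶻ x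
+ᶻ-comm {suc m} x y = toℕ-injective
  (trans (toℕ-+ᶻ x y) (trans (cong (_% suc m) (+-comm (toℕ x) (toℕ y))) (sym (toℕ-+ᶻ y x))))

module _ {m n : ℕ} .{{_ : NonZero n}} where

  -- T⟨ r ⟩ is I + Sʳ for the cyclic shift S, so that T = T⟨ 1 ⟩.
  T⟨_⟩ : ℕ → Vecᶻ m n → Vecᶻ m n
  T⟨ r ⟩ a i = a i +ᶻ a (i ⊕ r)

  T⟨⟩-cong : ∀ r {a b : Vecᶻ m n} → a ≗ b → T⟨ r ⟩ a ≗ T⟨ r ⟩ b
  T⟨⟩-cong r a≗b i = cong₂ _+ᶻ_ (a≗b i) (a≗b (i ⊕ r))

  T⟨⟩-mod : ∀ {r s} → r % n ≡ s % n → (a : Vecᶻ m n) → T⟨ r ⟩ a ≗ T⟨ s ⟩ a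
  T⟨⟩-mod eq a i = cong (λ j → a i +ᶻ a j) (⊕-cong i eq)

  T≗T⟨1⟩ : (a : Vecᶻ m n) → T a ≗ T⟨ 1 ⟩ a
  T≗T⟨1⟩ a i = cong (λ j → a i +ᶻ a j) (nextIdx≡⊕1 i)

module _ {p n : ℕ} .{{_ : NonZero p}} .{{_ : NonZero n}} where

  binomial : ∀ r k {N} → k < N → (a : Vecᶻ p n) (i : Fin n) →
             toℕ (fold a T⟨ r ⟩ k i) ≡ (∑[ l < N ] ((k C toℕ l) * toℕ (a (i ⊕ toℕ l * r)))) % p
  binomial r zero {suc N} _ a i = begin
    toℕ (a i)                         ≡⟨ m<n⇒m%n≡m (toℕ<n (a i)) ⟨
    toℕ (a i) % p                     ≡⟨ cong (λ j → toℕ (a j) % p) (⊕-identityʳ i) ⟨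
    w 0 % p                           ≡⟨ cong (_% p) (trans (+-identityʳ (1 * w 0)) (*-identityˡ (w 0))) ⟨
    (1 * w 0 + 0) % p                 ≡⟨ cong (λ x → (1 * w 0 + x) % p) (sum-replicate-zero N) ⟨
    (1 * w 0 + ∑[ l < N ] 0) % p      ∎
    where
      open ≡-Reasoning
      w : ℕ → ℕ
      w l = toℕ (a (i ⊕ l * r))
  binomial r (suc k) {suc N} (s<s k<N) a i = begin
    toℕ (T⟨ r ⟩ b i)                                 ≡⟨ toℕ-+ᶻ (b i) (b (i ⊕ r)) ⟩
    (toℕ (b i) + toℕ (b (i ⊕ r))) % p                ≡⟨ cong₂ (λ x y → (x + y) % p) IH₁ IH₂ ⟩
    (S₁ % p + S₂ % p) % p                            ≡⟨ %-distribˡ-+ S₁ S₂ p ⟨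
    (S₁ + S₂) % p                                    ≡⟨ cong (λ x → (S₁ + x) % p) (sum-cong-≗ {N} shift) ⟩
    (S₁ + ∑[ l < N ] ((k C toℕ l) * w (suc (toℕ l)))) % p
                                                     ≡⟨ cong (_% p) (∑-pascal k N w) ⟩
    (∑[ l < suc N ] ((suc k C toℕ l) * w (toℕ l))) % p ∎
    where
      open ≡-Reasoning
      b = fold a T⟨ r ⟩ k
      IH₁ = binomial r k (m<n⇒m<1+n k<N) a i
      IH₂ = binomial r k k<N a (i ⊕ r)
      w : ℕ → ℕ
      w l = toℕ (a (i ⊕ l * r))
      S₁ = ∑[ l < suc N ] ((k C toℕ l) * w (toℕ l))
      S₂ = ∑[ l < N ] ((k C toℕ l) * toℕ (a (i ⊕ r ⊕ toℕ l * r)))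
      shift : ∀ (l : Fin N) → (k C toℕ l) * toℕ (a (i ⊕ r ⊕ toℕ l * r)) ≡ (k C toℕ l) * w (suc (toℕ l))
      shift l = cong (λ j → (k C toℕ l) * toℕ (a j)) (⊕-assoc i r (toℕ l * r))

  frobenius : Prime p → ∀ r (a : Vecᶻ p n) → fold a T⟨ r ⟩ p ≗ T⟨ p * r ⟩ a
  frobenius p-prime r a i = toℕ-injective (begin
    toℕ (fold a T⟨ r ⟩ p i)                                ≡⟨ binomial r p (n<1+n p) a i ⟩
    (∑[ l < suc p ] ((p C toℕ l) * w (toℕ l))) % p         ≡⟨ ∑-C-prime p-prime w ⟩
    (w 0 + w p) % p                                        ≡⟨ cong (λ j → (toℕ (a j) + w p) % p) (⊕-identityʳ i) ⟩
    (toℕ (a i) + toℕ (a (i ⊕ p * r))) % p                  ≡⟨ toℕ-+ᶻ (a i) _ ⟨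
    toℕ (T⟨ p * r ⟩ a i)                                   ∎)
    where
      open ≡-Reasoning
      w : ℕ → ℕ
      w l = toℕ (a (i ⊕ l * r))

  Tⁱ[p^K]≗T⟨p^K⟩ : Prime p → ∀ K (a : Vecᶻ p n) → Tⁱ (p ^ K) a ≗ T⟨ p ^ K ⟩ a
  Tⁱ[p^K]≗T⟨p^K⟩ p-prime zero    a = T≗T⟨1⟩ a
  Tⁱ[p^K]≗T⟨p^K⟩ p-prime (suc K) a i =
    trans (Tⁱ-*-fold (T⟨⟩-cong (p ^ K)) (Tⁱ[p^K]≗T⟨p^K⟩ p-prime K) p a i)
          (frobenius p-prime (p ^ K) a i)

module _ {m n : ℕ} .{{_ : NonZero n}} {j : ℕ} (0<j : 0 < j)
         (Tʲ≗T⟨j⟩ : ∀ (a : Vecᶻ m n) → Tⁱ j a ≗ T⟨ j ⟩ a) where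

  private
    Tʲ⁻¹∘T≗T⟨j⟩ : ∀ a → Tⁱ (j ∸ 1) (T a) ≗ T⟨ j ⟩ a
    Tʲ⁻¹∘T≗T⟨j⟩ a i = trans (cong (λ x → x i) (sym (Tⁱ-suc (j ∸ 1) a)))
      (trans (cong (λ k → Tⁱ k a i) (m+[n∸m]≡n 0<j)) (Tʲ≗T⟨j⟩ a i))

  periodic₁-of-∣∸1 : n ∣ j ∸ 1 → ∀ a → Periodic₁ a (j ∸ 1)
  periodic₁-of-∣∸1 n∣j∸1 a i = begin
    Tⁱ (j ∸ 1) (T a) i   ≡⟨ Tʲ⁻¹∘T≗T⟨j⟩ a i ⟩
    T⟨ j ⟩ a i           ≡⟨ T⟨⟩-mod (∣∸1⇒%≡1 0<j n∣j∸1) a i ⟩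
    T⟨ 1 ⟩ a i           ≡⟨ T≗T⟨1⟩ a i ⟨
    T a i                ∎
    where open ≡-Reasoning

  -- As j ≡ -1 (mod n), T^(j-1) acts on the image of T as the rotation by n - 1,
  -- so n(j - 1) steps rotate by a multiple of n.
  periodic₁-of-∣+1 : n ∣ j + 1 → ∀ a → Periodic₁ a (n * (j ∸ 1))
  periodic₁-of-∣+1 n∣j+1 a i =
    trans (rotation n a i) (cong (T a) (trans (cong (i ⊕_) (*-comm n s)) (⊕-* i s)))
    where
      s = n ∸ 1

      Tʲ⁻¹-rotates : ∀ (x : Vecᶻ m n) i → Tⁱ (j ∸ 1) (T x) i ≡ T x (i ⊕ s)
      Tʲ⁻¹-rotates x i = begin
        Tⁱ (j ∸ 1) (T x) i            ≡⟨ Tʲ⁻¹∘T≗T⟨j⟩ x i ⟩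
        T⟨ j ⟩ x i                    ≡⟨ T⟨⟩-mod (∣+1⇒%≡-1 n∣j+1) x i ⟩
        x i +ᶻ x (i ⊕ s)              ≡⟨ +ᶻ-comm (x i) (x (i ⊕ s)) ⟩
        x (i ⊕ s) +ᶻ x i              ≡⟨ cong (λ k → x (i ⊕ s) +ᶻ x k) (nextIdx-⊕-∸1 i) ⟨
        T x (i ⊕ s)                   ∎
        where open ≡-Reasoning

      rotation : ∀ c (a : Vecᶻ m n) i → Tⁱ (c * (j ∸ 1)) (T a) i ≡ T a (i ⊕ c * s)
      rotation zero    a i = cong (T a) (sym (⊕-identityʳ i))
      rotation (suc c) a i = begin
        Tⁱ (j ∸ 1 + c * (j ∸ 1)) (T a) i       ≡⟨ cong (λ x → x i) (Tⁱ-+ (j ∸ 1) (c * (j ∸ 1)) (T a)) ⟩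
        Tⁱ (j ∸ 1) (Tⁱ (c * (j ∸ 1)) (T a)) i   ≡⟨ cong (λ x → Tⁱ (j ∸ 1) x i) (Tⁱ-suc (c * (j ∸ 1)) a) ⟨
        Tⁱ (j ∸ 1) (T (Tⁱ (c * (j ∸ 1)) a)) i   ≡⟨ Tʲ⁻¹-rotates (Tⁱ (c * (j ∸ 1)) a) i ⟩
        Tⁱ (suc (c * (j ∸ 1))) a (i ⊕ s)        ≡⟨ cong (λ x → x (i ⊕ s)) (Tⁱ-suc (c * (j ∸ 1)) a) ⟩
        Tⁱ (c * (j ∸ 1)) (T a) (i ⊕ s)          ≡⟨ rotation c a (i ⊕ s) ⟩
        T a (i ⊕ s ⊕ c * s)                     ≡⟨ cong (T a) (⊕-assoc i s (c * s)) ⟩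
        T a (i ⊕ (s + c * s))                   ∎
        where open ≡-Reasoning

proposition2p5 : ∀ (p n K : ℕ) → Prime p → 0 < n → 0 < K →
    (n ∣ p ^ K ∸ 1 → ∃[ P ] (IsPeriod p n P × P ∣ p ^ K ∸ 1)) ×
    (n ∣ p ^ K + 1 → ∃[ P ] (IsPeriod p n P × P ∣ n * (p ^ K ∸ 1)))
proposition2p5 p n K p-prime 0<n 0<K =
  (λ n∣p^K∸1 → uniformPeriod⇒period-∣ a₀ 0<p^K∸1 (periodic₁-of-∣∸1 0<p^K Tᵖ^ᴷ≗T⟨p^K⟩ n∣p^K∸1)) ,
  (λ n∣p^K+1 → uniformPeriod⇒period-∣ a₀ 0<n[p^K∸1] (periodic₁-of-∣+1 0<p^K Tᵖ^ᴷ≗T⟨p^K⟩ n∣p^K+1))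
  where
    instance
      p≢0 : NonZero p
      p≢0 = prime⇒nonZero p-prime
      n≢0 : NonZero n
      n≢0 = >-nonZero 0<n

    1<p^K : 1 < p ^ K
    1<p^K = ^-monoʳ-< p (nonTrivial⇒n>1 p {{prime⇒nonTrivial p-prime}}) 0<K

    0<p^K : 0 < p ^ K
    0<p^K = m^n>0 p K

    0<p^K∸1 : 0 < p ^ K ∸ 1
    0<p^K∸1 = m<n⇒0<n∸m 1<p^K

    0<n[p^K∸1] : 0 < n * (p ^ K ∸ 1)
    0<n[p^K∸1] = *-mono-≤ 0<n 0<p^K∸1

    Tᵖ^ᴷ≗T⟨p^K⟩ : ∀ (a : Vecᶻ p n) → Tⁱ (p ^ K) a ≗ T⟨ p ^ K ⟩ a
    Tᵖ^ᴷ≗T⟨p^K⟩ = Tⁱ[p^K]≗T⟨p^K⟩ p-prime K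

    a₀ : Vecᶻ p n
    a₀ _ = fromℕ< (>-nonZero⁻¹ p)
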